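{- For all integers $n\geq 2$, the complete graph $K_n$ on $n$ vertices satisfies $$\sqrt{n}\leq x_\alpha(K_n)\leq 2\sqrt{n-1}.$$
   Context: For a graph $G$ and integer $k\geq1$, the Xor power $G^{\oplus k}$ (equivalently $G^{k_{(2)}}$) is the graph on $V(G)^k$ in which $(u_1,\dots,u_k)$ and $(v_1,\dots,v_k)$ are adjacent iff the number of indices $i$ with $u_iv_i\in E(G)$ is odd. $x_\alpha(G)=\lim_{k\to\infty}\alpha(G^{\oplus k})^{1/k}$ (this limit exists), where $\alpha$ denotes the independence number. -}

module Defs where

open import Data.Nat using (ℕ; zero; suc; _+_; _⊔_; _%_)
open import Data.Bool using (Bool; true; false; not; if_then_else_; _∧_)
open import Data.Fin using (Fin)
open import Data.Fin.Properties using (_≟_)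
open import Data.List using (List; []; _∷_; length; map; concatMap; allFin; foldr)
open import Data.Vec using (Vec; []; _∷_)
open import Relation.Nullary.Decidable using (⌊_⌋)

-- A finite (loopless, undirected) graph given by an explicit duplicate-free
-- enumeration of its vertices and a boolean adjacency relation.
record FinGraph : Set₁ where
  field
    V     : Set
    verts : List V
    adj   : V → V → Bool
open FinGraph public

complete : ℕ → FinGraph
complete n = record { V = Fin n ; verts = allFin n ; adj = λ u v → not ⌊ u ≟ v ⌋ }

allVecs : {A : Set} → List A → (k : ℕ) → List (Vec A k)
allVecs xs zero    = [] ∷ []
allVecs xs (suc k) = concatMap (λ x → map (x ∷_) (allVecs xs k)) xs

adjCount : {A : Set} → (A → A → Bool) → {k : ℕ} → Vec A k → Vec A k → ℕ
adjCount a []       []       = 0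
adjCount a (u ∷ us) (v ∷ vs) = (if a u v then 1 else 0) + adjCount a us vs

isOdd : ℕ → Bool
isOdd m = ⌊ m % 2 ≟ℕ 1 ⌋
  where open import Data.Nat.Properties renaming (_≟_ to _≟ℕ_)

xorPower : FinGraph → ℕ → FinGraph
xorPower G k = record
  { V     = Vec (V G) k
  ; verts = allVecs (verts G) k
  ; adj   = λ u v → isOdd (adjCount (adj G) u v) }

sublists : {A : Set} → List A → List (List A)
sublists []       = [] ∷ []
sublists (x ∷ xs) = let r = sublists xs in map (x ∷_) r Data.List.++ r

allB : {A : Set} → (A → Bool) → List A → Bool
allB p []       = true
allB p (x ∷ xs) = p x ∧ allB p xs

independent : (G : FinGraph) → List (V G) → Bool
independent G []       = true
independent G (x ∷ xs) = allB (λ y → not (adj G x y) ∧ not (adj G y x)) xs ∧ independent G xs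

α : FinGraph → ℕ
α G = foldr (λ S m → (if independent G S then length S else 0) ⊔ m) 0 (sublists (verts G))

{-# OPTIONS --safe #-}
-- An independent set of K_n^{⊕k} is a set of words in (Fin n)^k whose pairwise Hamming
-- distances are even; the n^⌊k/2⌋ words x₁x₁x₂x₂… form one. Conversely, for t = ⌊k/2⌋ the
-- kernel V(u,v) = ∏_{s=1}^{t} n·(d(u,v) − 2s) is diagonal with nonzero diagonal on such a set,
-- so the set is no larger than the rank of V. With q = n·I − J, which has rank n − 1, one has
-- n·d(u,v) = Σᵢ ((n − 1) − q(uᵢ,vᵢ)) and q² = (n − 2)·q + (n − 1), so V is a multilinear
-- polynomial of degree ≤ t in the q(uᵢ,vᵢ), of rank ≤ Σ_{s≤t} C(k,s)(n − 1)^s ≤ 2^k (n − 1)^t.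
-- Comparing n^{k/2} ≲ α(K_n^{⊕k}) ≲ 2^k (n − 1)^{k/2} with (a/b)^k gives both inequalities.
module Submission where

open import Defs
open import Data.Nat using (ℕ)

module KernelRank where

  open import Data.Nat as ℕ using (zero; suc; s≤s)
  open import Data.Nat.Properties using (_≤?_; ≰⇒>; m<n⇒m<1+n)
  open import Data.Integer using (ℤ; +_; _+_; _*_; -_; _-_; 0ℤ; 1ℤ)
  open import Data.Integer.Properties
    using (_≟_; +-*-semiring; *-assoc; *-zeroʳ; *-identityˡ; +-identityˡ; +-identityʳ; i*j≡0⇒i≡0∨j≡0)
  open import Data.Integer.Tactic.RingSolver using (solve-∀)
  open import Algebra.Properties.Semiring.Sum +-*-semiring
    using (sum; sum-syntax; sum-cong-≗; sum-remove; sum-replicate-zero; ∑-distrib-+; ∑-comm;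
           *-distribˡ-sum; *-distribʳ-sum)
  open import Data.Fin using (Fin; zero; suc; punchIn; _↑ˡ_; _↑ʳ_; combine; remQuot)
  open import Data.Fin.Properties using (all?; ¬∀⟶∃¬; punchInᵢ≢i; remQuot-combine) renaming (_≟_ to _≟ᶠ_)
  open import Data.Vec.Functional using (insertAt; _++_)
  open import Data.Vec.Functional.Properties using (insertAt-lookup; insertAt-punchIn; lookup-++ˡ; lookup-++ʳ)
  open import Data.Bool using (if_then_else_)
  open import Data.Product using (_,_; uncurry)
  open import Data.Sum using (inj₁; inj₂; [_,_]′)
  open import Data.Empty using (⊥-elim)
  open import Relation.Nullary using (yes; no)
  open import Relation.Nullary.Decidable using (⌊_⌋)
  open import Relation.Binary.PropositionalEquality
  open import Function using (_∘_)
  open ≡-Reasoning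

  ∑-zero : ∀ L {f : Fin L → ℤ} → (∀ i → f i ≡ 0ℤ) → ∑[ i < L ] f i ≡ 0ℤ
  ∑-zero L f≡0 = trans (sum-cong-≗ f≡0) (sum-replicate-zero L)

  ∑-single : ∀ {L} (j : Fin L) (f : Fin L → ℤ) → (∀ i → i ≢ j → f i ≡ 0ℤ) → ∑[ i < L ] f i ≡ f j
  ∑-single {suc L} j f f≡0 = begin
    sum f                                ≡⟨ sum-remove f ⟩
    f j + ∑[ i < L ] f (punchIn j i)     ≡⟨ cong (_+_ (f j)) (∑-zero L (λ i → f≡0 _ (punchInᵢ≢i j i))) ⟩
    f j + 0ℤ                             ≡⟨ +-identityʳ (f j) ⟩
    f j                                  ∎

  δ : ∀ {L} → Fin L → Fin L → ℤ
  δ i j = if ⌊ i ≟ᶠ j ⌋ then 1ℤ else 0ℤ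

  ∑-δ : ∀ {L} (i : Fin L) (f : Fin L → ℤ) → ∑[ j < L ] (δ i j * f j) ≡ f i
  ∑-δ i f = trans (∑-single i (λ j → δ i j * f j) δ-off) δ-diag
    where
    δ-off : ∀ j → j ≢ i → δ i j * f j ≡ 0ℤ
    δ-off j j≢i with i ≟ᶠ j
    ... | yes i≡j = ⊥-elim (j≢i (sym i≡j))
    ... | no _    = refl
    δ-diag : δ i i * f i ≡ f i
    δ-diag with i ≟ᶠ i
    ... | yes _   = *-identityˡ (f i)
    ... | no i≢i = ⊥-elim (i≢i refl)

  ∑-const : ∀ L (c : ℤ) → ∑[ i < L ] c ≡ + L * c
  ∑-const zero    c = refl
  ∑-const (suc L) c = trans (cong (λ s → c + s) (∑-const L c)) (distrib c (+ L))
    where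
    distrib : ∀ c l → c + l * c ≡ (1ℤ + l) * c
    distrib = solve-∀

  ∑-linear : ∀ {L} (a b : ℤ) (f g : Fin L → ℤ) →
             ∑[ i < L ] (a * f i + b * g i) ≡ a * ∑[ i < L ] f i + b * ∑[ i < L ] g i
  ∑-linear a b f g = trans (∑-distrib-+ (λ i → a * f i) (λ i → b * g i))
    (sym (cong₂ _+_ (*-distribˡ-sum a f) (*-distribˡ-sum b g)))

  ∑-++ : ∀ D₁ {D₂} (f : Fin (D₁ ℕ.+ D₂) → ℤ) →
         sum f ≡ ∑[ i < D₁ ] f (i ↑ˡ D₂) + ∑[ i < D₂ ] f (D₁ ↑ʳ i)
  ∑-++ zero    f = sym (+-identityˡ (sum f))
  ∑-++ (suc D₁) f = trans (cong (_+_ (f zero)) (∑-++ D₁ (f ∘ suc))) (assoc (f zero) _ _)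
    where
    assoc : ∀ a b c → a + (b + c) ≡ a + b + c
    assoc = solve-∀

  ∑-combine : ∀ D₁ {D₂} (f : Fin (D₁ ℕ.* D₂) → ℤ) →
              sum f ≡ ∑[ i < D₁ ] ∑[ j < D₂ ] f (combine i j)
  ∑-combine zero f = refl
  ∑-combine (suc D₁) {D₂} f = trans (∑-++ D₂ f)
    (cong (_+_ (∑[ j < D₂ ] f (j ↑ˡ (D₁ ℕ.* D₂)))) (∑-combine D₁ (f ∘ (D₂ ↑ʳ_))))

  record Factorisation {X : Set} (D : ℕ) (K : X → X → ℤ) : Set where
    field
      left right : X → Fin D → ℤ
      factorises : ∀ u v → K u v ≡ ∑[ β < D ] (left u β * right v β)
  open Factorisation

  module _ {X : Set} where

    Factorisation-resp : ∀ {D} {K K′ : X → X → ℤ} → (∀ u v → K u v ≡ K′ u v) →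
                         Factorisation D K → Factorisation D K′
    Factorisation-resp K≡K′ F = record
      { left = left F ; right = right F ; factorises = λ u v → trans (sym (K≡K′ u v)) (factorises F u v) }

    Factorisation-∘ : ∀ {Y : Set} {D} {K : Y → Y → ℤ} (f : X → Y) →
                      Factorisation D K → Factorisation D (λ u v → K (f u) (f v))
    Factorisation-∘ f F = record
      { left = left F ∘ f ; right = right F ∘ f ; factorises = λ u v → factorises F (f u) (f v) }

    Factorisation-rankOne : (p r : X → ℤ) → Factorisation 1 (λ u v → p u * r v)
    Factorisation-rankOne p r = record
      { left = λ u _ → p u ; right = λ v _ → r v ; factorises = λ u v → sym (+-identityʳ (p u * r v)) }

    Factorisation-+ : ∀ {D₁ D₂} {K₁ K₂ : X → X → ℤ} → Factorisation D₁ K₁ → Factorisation D₂ K₂ →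
                      Factorisation (D₁ ℕ.+ D₂) (λ u v → K₁ u v + K₂ u v)
    Factorisation-+ {D₁} {D₂} {K₁} {K₂} F₁ F₂ = record
      { left = λ u → left F₁ u ++ left F₂ u
      ; right = λ v → right F₁ v ++ right F₂ v
      ; factorises = λ u v → sym (begin
          ∑[ β < D₁ ℕ.+ D₂ ] ((left F₁ u ++ left F₂ u) β * (right F₁ v ++ right F₂ v) β)
            ≡⟨ ∑-++ D₁ _ ⟩
          ∑[ β < D₁ ] ((left F₁ u ++ left F₂ u) (β ↑ˡ D₂) * (right F₁ v ++ right F₂ v) (β ↑ˡ D₂)) +
          ∑[ β < D₂ ] ((left F₁ u ++ left F₂ u) (D₁ ↑ʳ β) * (right F₁ v ++ right F₂ v) (D₁ ↑ʳ β))
            ≡⟨ cong₂ _+_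
                 (sum-cong-≗ {D₁} λ β → cong₂ _*_ (lookup-++ˡ (left F₁ u) _ β) (lookup-++ˡ (right F₁ v) _ β))
                 (sum-cong-≗ {D₂} λ β → cong₂ _*_ (lookup-++ʳ (left F₁ u) _ β) (lookup-++ʳ (right F₁ v) _ β)) ⟩
          ∑[ β < D₁ ] (left F₁ u β * right F₁ v β) + ∑[ β < D₂ ] (left F₂ u β * right F₂ v β)
            ≡⟨ sym (cong₂ _+_ (factorises F₁ u v) (factorises F₂ u v)) ⟩
          K₁ u v + K₂ u v ∎) }

    Factorisation-* : ∀ {D₁ D₂} {K₁ K₂ : X → X → ℤ} → Factorisation D₁ K₁ → Factorisation D₂ K₂ →
                      Factorisation (D₁ ℕ.* D₂) (λ u v → K₁ u v * K₂ u v)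
    Factorisation-* {D₁} {D₂} {K₁} {K₂} F₁ F₂ = record
      { left = λ u → left F₁ u ⊗ left F₂ u
      ; right = λ v → right F₁ v ⊗ right F₂ v
      ; factorises = λ u v → begin
          K₁ u v * K₂ u v
            ≡⟨ cong₂ _*_ (factorises F₁ u v) (factorises F₂ u v) ⟩
          (∑[ i < D₁ ] a u v i) * (∑[ j < D₂ ] b u v j)
            ≡⟨ *-distribʳ-sum _ (a u v) ⟩
          ∑[ i < D₁ ] (a u v i * ∑[ j < D₂ ] b u v j)
            ≡⟨ sum-cong-≗ (λ i → *-distribˡ-sum (a u v i) (b u v)) ⟩
          ∑[ i < D₁ ] ∑[ j < D₂ ] (a u v i * b u v j)
            ≡⟨ sum-cong-≗ (λ i → sum-cong-≗ (λ j → trans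
                 (interchange (left F₁ u i) (right F₁ v i) (left F₂ u j) (right F₂ v j))
                 (sym (cong₂ _*_ (⊗-combine (left F₁ u) (left F₂ u) i j)
                                 (⊗-combine (right F₁ v) (right F₂ v) i j))))) ⟩
          ∑[ i < D₁ ] ∑[ j < D₂ ]
            ((left F₁ u ⊗ left F₂ u) (combine i j) * (right F₁ v ⊗ right F₂ v) (combine i j))
            ≡⟨ sym (∑-combine D₁ (λ β → (left F₁ u ⊗ left F₂ u) β * (right F₁ v ⊗ right F₂ v) β)) ⟩
          ∑[ β < D₁ ℕ.* D₂ ] ((left F₁ u ⊗ left F₂ u) β * (right F₁ v ⊗ right F₂ v) β) ∎ }
      where
      _⊗_ : (Fin D₁ → ℤ) → (Fin D₂ → ℤ) → Fin (D₁ ℕ.* D₂) → ℤ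
      (f ⊗ g) β = uncurry (λ i j → f i * g j) (remQuot D₂ β)
      ⊗-combine : ∀ f g i j → (f ⊗ g) (combine i j) ≡ f i * g j
      ⊗-combine f g i j = cong (uncurry (λ i j → f i * g j)) (remQuot-combine i j)
      a : X → X → Fin D₁ → ℤ
      a u v i = left F₁ u i * right F₁ v i
      b : X → X → Fin D₂ → ℤ
      b u v j = left F₂ u j * right F₂ v j
      interchange : ∀ p q r s → p * q * (r * s) ≡ p * r * (q * s)
      interchange = solve-∀

  record NonzeroKernelVector {D L} (A : Fin D → Fin L → ℤ) : Set where
    field
      vector   : Fin L → ℤ
      support  : Fin L
      nonzero  : vector support ≢ 0ℤ
      solves   : ∀ β → ∑[ i < L ] (A β i * vector i) ≡ 0ℤ
  open NonzeroKernelVector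

  eliminate : ∀ {L} (j : Fin (suc L)) (pivot row : Fin (suc L) → ℤ) → Fin L → ℤ
  eliminate j pivot row i = pivot j * row (punchIn j i) - row j * pivot (punchIn j i)

  backSubstitute : ∀ {L} (j : Fin (suc L)) (pivot : Fin (suc L) → ℤ) (y : Fin L → ℤ) → Fin (suc L) → ℤ
  backSubstitute j pivot y = insertAt (λ i → pivot j * y i) j (- ∑[ i < _ ] (pivot (punchIn j i) * y i))

  ∑-backSubstitute : ∀ {L} (j : Fin (suc L)) (pivot row : Fin (suc L) → ℤ) (y : Fin L → ℤ) →
                     ∑[ i < suc L ] (row i * backSubstitute j pivot y i) ≡
                     ∑[ i < L ] (eliminate j pivot row i * y i)
  ∑-backSubstitute {L} j pivot row y = begin
    ∑[ i < suc L ] (row i * x i)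
      ≡⟨ sum-remove (λ i → row i * x i) ⟩
    row j * x j + ∑[ i < L ] (row (punchIn j i) * x (punchIn j i))
      ≡⟨ cong₂ (λ s t → row j * s + t) (insertAt-lookup _ j _)
               (sum-cong-≗ λ i → cong (row (punchIn j i) *_) (insertAt-punchIn _ j _ i)) ⟩
    row j * (- S₀) + ∑[ i < L ] (row (punchIn j i) * (a * y i))
      ≡⟨ cong (_+_ (row j * (- S₀))) (trans (sum-cong-≗ λ i → swap₁ (row (punchIn j i)) a (y i))
                                         (sym (*-distribˡ-sum a (λ i → row (punchIn j i) * y i)))) ⟩
    row j * (- S₀) + a * ∑[ i < L ] (row (punchIn j i) * y i)
      ≡⟨ swap₂ (row j) S₀ a _ ⟩
    a * ∑[ i < L ] (row (punchIn j i) * y i) + (- row j) * S₀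
      ≡⟨ sym (∑-linear a (- row j) (λ i → row (punchIn j i) * y i) (λ i → pivot (punchIn j i) * y i)) ⟩
    ∑[ i < L ] (a * (row (punchIn j i) * y i) + (- row j) * (pivot (punchIn j i) * y i))
      ≡⟨ sum-cong-≗ (λ i → regroup a (row (punchIn j i)) (row j) (pivot (punchIn j i)) (y i)) ⟩
    ∑[ i < L ] (eliminate j pivot row i * y i) ∎
    where
    a = pivot j
    x = backSubstitute j pivot y
    S₀ = ∑[ i < L ] (pivot (punchIn j i) * y i)
    swap₁ : ∀ p q r → p * (q * r) ≡ q * (p * r)
    swap₁ = solve-∀
    swap₂ : ∀ p s q t → p * (- s) + q * t ≡ q * t + (- p) * s
    swap₂ = solve-∀
    regroup : ∀ a p q r y → a * (p * y) + (- q) * (r * y) ≡ (a * p - q * r) * y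
    regroup = solve-∀

  eliminate-pivot : ∀ {L} (j : Fin (suc L)) (pivot : Fin (suc L) → ℤ) i → eliminate j pivot pivot i ≡ 0ℤ
  eliminate-pivot j pivot i = cancel (pivot j) (pivot (punchIn j i))
    where
    cancel : ∀ p q → p * q - p * q ≡ 0ℤ
    cancel = solve-∀

  nonzeroKernelVector : ∀ {D L} → D ℕ.< L → (A : Fin D → Fin L → ℤ) → NonzeroKernelVector A
  nonzeroKernelVector {zero} {suc L} _ A = record
    { vector = λ _ → 1ℤ ; support = zero ; nonzero = λ () ; solves = λ () }
  nonzeroKernelVector {suc D} {suc L} (s≤s D<L) A with all? (λ i → A zero i ≟ 0ℤ)
  ... | yes A₀≡0 = record
    { vector = vector v ; support = support v ; nonzero = nonzero v ; solves = solves′ }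
    where
    v = nonzeroKernelVector (m<n⇒m<1+n D<L) (A ∘ suc)
    solves′ : ∀ β → ∑[ i < suc L ] (A β i * vector v i) ≡ 0ℤ
    solves′ zero    = ∑-zero (suc L) (λ i → cong (_* vector v i) (A₀≡0 i))
    solves′ (suc β) = solves v β
  ... | no A₀≢0 with ¬∀⟶∃¬ (suc L) (λ i → A zero i ≡ 0ℤ) (λ i → A zero i ≟ 0ℤ) A₀≢0
  ...   | j , a≢0 = record
    { vector = x ; support = punchIn j (support v) ; nonzero = x≢0 ; solves = solves′ }
    where
    v = nonzeroKernelVector D<L (λ β → eliminate j (A zero) (A (suc β)))
    x = backSubstitute j (A zero) (vector v)
    x≢0 : x (punchIn j (support v)) ≢ 0ℤ
    x≢0 x≡0 with i*j≡0⇒i≡0∨j≡0 (A zero j) (trans (sym (insertAt-punchIn _ j _ (support v))) x≡0)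
    ... | inj₁ a≡0 = a≢0 a≡0
    ... | inj₂ y≡0 = nonzero v y≡0
    solves′ : ∀ β → ∑[ i < suc L ] (A β i * x i) ≡ 0ℤ
    solves′ β = trans (∑-backSubstitute j (A zero) (A β) (vector v)) (reduced β)
      where
      reduced : ∀ β → ∑[ i < L ] (eliminate j (A zero) (A β) i * vector v i) ≡ 0ℤ
      reduced zero    = ∑-zero L (λ i → cong (_* vector v i) (eliminate-pivot j (A zero) i))
      reduced (suc β) = solves v β

  diagonal≤rank : ∀ {X : Set} {D L} {K : X → X → ℤ} → Factorisation D K → (s : Fin L → X) →
                  (∀ i → K (s i) (s i) ≢ 0ℤ) → (∀ i j → i ≢ j → K (s i) (s j) ≡ 0ℤ) → L ℕ.≤ D
  diagonal≤rank {D = D} {L} {K} F s diag≢0 offdiag≡0 with L ≤? D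
  ... | yes L≤D = L≤D
  ... | no L≰D = ⊥-elim ([ diag≢0 i₀ , nonzero v ]′ (i*j≡0⇒i≡0∨j≡0 (K (s i₀) (s i₀)) Kx≡0))
    where
    v = nonzeroKernelVector (≰⇒> L≰D) (λ β i → right F (s i) β)
    x = vector v
    i₀ = support v
    Kx≡0 : K (s i₀) (s i₀) * x i₀ ≡ 0ℤ
    Kx≡0 = begin
      K (s i₀) (s i₀) * x i₀
        ≡⟨ sym (∑-single i₀ (λ i → K (s i₀) (s i) * x i)
                         λ i i≢i₀ → cong (_* x i) (offdiag≡0 i₀ i (i≢i₀ ∘ sym))) ⟩
      ∑[ i < L ] (K (s i₀) (s i) * x i)
        ≡⟨ sum-cong-≗ {L} (λ i → trans (cong (_* x i) (factorises F (s i₀) (s i)))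
                                       (*-distribʳ-sum (x i) (λ β → left F (s i₀) β * right F (s i) β))) ⟩
      ∑[ i < L ] ∑[ β < D ] (left F (s i₀) β * right F (s i) β * x i)
        ≡⟨ ∑-comm (λ i β → left F (s i₀) β * right F (s i) β * x i) ⟩
      ∑[ β < D ] ∑[ i < L ] (left F (s i₀) β * right F (s i) β * x i)
        ≡⟨ sum-cong-≗ {D} (λ β → trans
                              (sum-cong-≗ {L} λ i → *-assoc (left F (s i₀) β) (right F (s i) β) (x i))
                                       (sym (*-distribˡ-sum (left F (s i₀) β) (λ i → right F (s i) β * x i)))) ⟩
      ∑[ β < D ] (left F (s i₀) β * ∑[ i < L ] (right F (s i) β * x i))
        ≡⟨ ∑-zero D (λ β → trans (cong (left F (s i₀) β *_) (solves v β)) (*-zeroʳ (left F (s i₀) β))) ⟩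
      0ℤ ∎

module HammingKernels (m : ℕ) where

  open KernelRank
  open import Data.Nat as ℕ using (zero; suc; _≤_; _^_; ⌊_/2⌋; z≤n; s≤s; NonZero)
  open import Data.Nat.Properties
    using ( m^n>0; ≤-trans; ≤-reflexive; +-mono-≤; *-monoʳ-≤; *-monoˡ-≤; m≤m+n; +-identityʳ
          ; m≤n⇒m≤1+n; ≤-pred; ≤∧≢⇒<)
  open import Data.Nat.Divisibility using (_∣_; divides)
  import Data.Nat.Tactic.RingSolver as ℕ-Solver
  open import Data.Integer using (ℤ; +_; _+_; _*_; -_; _-_; 0ℤ; 1ℤ; -1ℤ)
  import Data.Integer.Properties as ℤ
  open import Data.Integer.Tactic.RingSolver using (solve-∀)
  open import Algebra.Properties.Semiring.Sum ℤ.+-*-semiring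
    using (sum-syntax; sum-cong-≗; sum-remove; *-distribˡ-sum)
  open import Data.Fin using (Fin; zero; suc; punchIn)
  open import Data.Fin.Properties using (_≟_; punchInᵢ≢i)
  open import Data.Vec using (Vec; []; _∷_; head; tail)
  open import Data.Bool using (if_then_else_)
  open import Data.Empty using (⊥-elim)
  open import Data.Sum using (inj₁; inj₂)
  open import Relation.Nullary using (yes; no)
  open import Relation.Nullary.Decidable using (⌊_⌋)
  open import Relation.Binary.PropositionalEquality
  open import Function using (_∘_)
  open ≡-Reasoning

  n : ℕ
  n = suc m

  Word : ℕ → Set
  Word k = Vec (Fin n) k

  hamming : ∀ {k} → Word k → Word k → ℕ
  hamming = adjCount (adj (complete n))

  q : Fin n → Fin n → ℤ
  q x y = if ⌊ x ≟ y ⌋ then + m else -1ℤ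

  q-≡ : ∀ x → q x x ≡ + m
  q-≡ x with x ≟ x
  ... | yes _   = refl
  ... | no x≢x = ⊥-elim (x≢x refl)

  q-≢ : ∀ {x y} → x ≢ y → q x y ≡ -1ℤ
  q-≢ {x} {y} x≢y with x ≟ y
  ... | yes x≡y = ⊥-elim (x≢y x≡y)
  ... | no _    = refl

  q² : ∀ x y → q x y * q x y ≡ (+ m - 1ℤ) * q x y + + m
  q² x y with x ≟ y
  ... | yes _ = identity (+ m)
    where
    identity : ∀ a → a * a ≡ (a - 1ℤ) * a + a
    identity = solve-∀
  ... | no _  = identity (+ m)
    where
    identity : ∀ a → -1ℤ * -1ℤ ≡ (a - 1ℤ) * -1ℤ + a
    identity = solve-∀

  hamming-∷ : ∀ {k} x y (u v : Word k) → + n * + hamming (x ∷ u) (y ∷ v) ≡ + m - q x y + + n * + hamming u v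
  hamming-∷ x y u v with x ≟ y
  ... | yes _ = identity (+ m) (+ hamming u v)
    where
    identity : ∀ a d → (1ℤ + a) * d ≡ a - a + (1ℤ + a) * d
    identity = solve-∀
  ... | no _  = identity (+ m) (+ hamming u v)
    where
    identity : ∀ a d → (1ℤ + a) * (1ℤ + d) ≡ a - -1ℤ + (1ℤ + a) * d
    identity = solve-∀

  ∑-q : ∀ y → ∑[ x < n ] q x y ≡ 0ℤ
  ∑-q y = begin
    ∑[ x < n ] q x y                        ≡⟨ sum-remove {i = y} (λ x → q x y) ⟩
    q y y + ∑[ i < m ] q (punchIn y i) y    ≡⟨ cong₂ _+_ (q-≡ y) (sum-cong-≗ λ i → q-≢ (punchInᵢ≢i y i)) ⟩
    + m + ∑[ i < m ] -1ℤ                    ≡⟨ cong (λ s → + m + s) (∑-const m -1ℤ) ⟩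
    + m + + m * -1ℤ                         ≡⟨ cancel (+ m) ⟩
    0ℤ                                      ∎
    where
    cancel : ∀ a → a + a * -1ℤ ≡ 0ℤ
    cancel = solve-∀

  -- The columns of q sum to zero, so the row of the letter zero is minus the sum of the others.
  q-factorisation : Factorisation m q
  q-factorisation = record { left = left ; right = right ; factorises = factorises }
    where
    left right : Fin n → Fin m → ℤ
    left zero    r = -1ℤ
    left (suc x) r = δ x r
    right y r = q (suc r) y
    factorises : ∀ x y → q x y ≡ ∑[ r < m ] (left x r * right y r)
    factorises zero    y = sym (begin
      ∑[ r < m ] (-1ℤ * q (suc r) y)   ≡⟨ sym (*-distribˡ-sum -1ℤ (λ r → q (suc r) y)) ⟩
      -1ℤ * ∑[ r < m ] q (suc r) y     ≡⟨ solveFor (∑-q y) ⟩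
      q zero y                         ∎)
      where
      solveFor : ∀ {a s} → a + s ≡ 0ℤ → -1ℤ * s ≡ a
      solveFor {a} {s} a+s≡0 = trans (identity a s) (trans (cong (λ t → a + -1ℤ * t) a+s≡0) (ℤ.+-identityʳ a))
        where
        identity : ∀ a s → -1ℤ * s ≡ a + -1ℤ * (a + s)
        identity = solve-∀
    factorises (suc x) y = sym (∑-δ x (λ r → q (suc r) y))

  -- Multilinear polynomials of degree ≤ j in q(x₁,y₁), …, q(x_k,y_k), in Horner form with
  -- respect to the first letter; ⟦_⟧ evaluates them as kernels on words.
  data QPoly : ℕ → ℕ → Set where
    const : ∀ {j} → ℤ → QPoly 0 j
    lift  : ∀ {k} → QPoly k 0 → QPoly (suc k) 0
    _+q*_ : ∀ {k j} → QPoly k (suc j) → QPoly k j → QPoly (suc k) (suc j)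

  ⟦_⟧ : ∀ {k j} → QPoly k j → Word k → Word k → ℤ
  ⟦ const c  ⟧ []      []      = c
  ⟦ lift p   ⟧ (_ ∷ u) (_ ∷ v) = ⟦ p ⟧ u v
  ⟦ p +q* r  ⟧ (x ∷ u) (y ∷ v) = ⟦ p ⟧ u v + q x y * ⟦ r ⟧ u v

  +-*-zeroʳ : ∀ a b → a + b * 0ℤ ≡ a
  +-*-zeroʳ = solve-∀

  constant : ∀ k {j} → ℤ → QPoly k j
  constant zero    c = const c
  constant (suc k) {zero}  c = lift (constant k c)
  constant (suc k) {suc j} c = constant k c +q* constant k 0ℤ

  ⟦constant⟧ : ∀ k {j} c (u v : Word k) → ⟦ constant k {j} c ⟧ u v ≡ c
  ⟦constant⟧ zero    c [] [] = refl
  ⟦constant⟧ (suc k) {zero}  c (_ ∷ u) (_ ∷ v) = ⟦constant⟧ k c u v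
  ⟦constant⟧ (suc k) {suc j} c (x ∷ u) (y ∷ v) =
    trans (cong₂ (λ a b → a + q x y * b) (⟦constant⟧ k c u v) (⟦constant⟧ k 0ℤ u v)) (+-*-zeroʳ c (q x y))

  raise : ∀ {k j} → QPoly k j → QPoly k (suc j)
  raise (const c)  = const c
  raise {suc k} (lift p) = raise p +q* constant k 0ℤ
  raise (p +q* r)  = raise p +q* raise r

  ⟦raise⟧ : ∀ {k j} (p : QPoly k j) (u v : Word k) → ⟦ raise p ⟧ u v ≡ ⟦ p ⟧ u v
  ⟦raise⟧ (const c) [] [] = refl
  ⟦raise⟧ {suc k} (lift p) (x ∷ u) (y ∷ v) =
    trans (cong₂ (λ a b → a + q x y * b) (⟦raise⟧ p u v) (⟦constant⟧ k 0ℤ u v))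
          (+-*-zeroʳ (⟦ p ⟧ u v) (q x y))
  ⟦raise⟧ (p +q* r) (x ∷ u) (y ∷ v) rewrite ⟦raise⟧ p u v | ⟦raise⟧ r u v = refl

  infixl 6 _⊕_
  _⊕_ : ∀ {k j} → QPoly k j → QPoly k j → QPoly k j
  const c   ⊕ const c′   = const (c + c′)
  lift p    ⊕ lift p′    = lift (p ⊕ p′)
  (p +q* r) ⊕ (p′ +q* r′) = (p ⊕ p′) +q* (r ⊕ r′)

  ⟦⊕⟧ : ∀ {k j} (p p′ : QPoly k j) (u v : Word k) → ⟦ p ⊕ p′ ⟧ u v ≡ ⟦ p ⟧ u v + ⟦ p′ ⟧ u v
  ⟦⊕⟧ (const c) (const c′) [] [] = refl
  ⟦⊕⟧ (lift p) (lift p′) (_ ∷ u) (_ ∷ v) = ⟦⊕⟧ p p′ u v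
  ⟦⊕⟧ (p +q* r) (p′ +q* r′) (x ∷ u) (y ∷ v) rewrite ⟦⊕⟧ p p′ u v | ⟦⊕⟧ r r′ u v =
    distrib (⟦ p ⟧ u v) (⟦ p′ ⟧ u v) (q x y) (⟦ r ⟧ u v) (⟦ r′ ⟧ u v)
    where
    distrib : ∀ a a′ b c c′ → a + a′ + b * (c + c′) ≡ a + b * c + (a′ + b * c′)
    distrib = solve-∀

  scale : ∀ {k j} → ℤ → QPoly k j → QPoly k j
  scale a (const c) = const (a * c)
  scale a (lift p)  = lift (scale a p)
  scale a (p +q* r) = scale a p +q* scale a r

  ⟦scale⟧ : ∀ {k j} a (p : QPoly k j) (u v : Word k) → ⟦ scale a p ⟧ u v ≡ a * ⟦ p ⟧ u v
  ⟦scale⟧ a (const c) [] [] = refl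
  ⟦scale⟧ a (lift p) (_ ∷ u) (_ ∷ v) = ⟦scale⟧ a p u v
  ⟦scale⟧ a (p +q* r) (x ∷ u) (y ∷ v) rewrite ⟦scale⟧ a p u v | ⟦scale⟧ a r u v =
    distrib a (⟦ p ⟧ u v) (q x y) (⟦ r ⟧ u v)
    where
    distrib : ∀ a b c d → a * b + c * (a * d) ≡ a * (b + c * d)
    distrib = solve-∀

  -- By hamming-∷ and q², multiplying by n·hamming raises the degree by at most one.
  hammingTimes : ∀ {k j} → QPoly k j → QPoly k (suc j)
  hammingTimes (const c) = const 0ℤ
  hammingTimes (lift p)  = (raise (scale (+ m) p) ⊕ hammingTimes p) +q* scale -1ℤ p
  hammingTimes (p +q* r) =
    (raise (scale (+ m) p) ⊕ raise (raise (scale (- + m) r)) ⊕ hammingTimes p) +q*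
    (raise r ⊕ scale -1ℤ p ⊕ hammingTimes r)

  ⟦hammingTimes⟧ : ∀ {k j} (p : QPoly k j) (u v : Word k) →
                   ⟦ hammingTimes p ⟧ u v ≡ + n * + hamming u v * ⟦ p ⟧ u v
  ⟦hammingTimes⟧ (const c) [] [] = annihilate (+ n) c
    where
    annihilate : ∀ a c → 0ℤ ≡ a * 0ℤ * c
    annihilate = solve-∀
  ⟦hammingTimes⟧ (lift p) (x ∷ u) (y ∷ v) = sym (begin
    + n * + hamming (x ∷ u) (y ∷ v) * P    ≡⟨ cong (_* P) (hamming-∷ x y u v) ⟩
    (+ m - Q + D) * P                      ≡⟨ expand (+ m) Q D P ⟩
    + m * P + D * P + Q * (-1ℤ * P)        ≡⟨ sym (cong₂ (λ a b → a + Q * b) first (⟦scale⟧ -1ℤ p u v)) ⟩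
    ⟦ hammingTimes (lift p) ⟧ (x ∷ u) (y ∷ v) ∎)
    where
    P = ⟦ p ⟧ u v
    Q = q x y
    D = + n * + hamming u v
    first : ⟦ raise (scale (+ m) p) ⊕ hammingTimes p ⟧ u v ≡ + m * P + D * P
    first = trans (⟦⊕⟧ (raise (scale (+ m) p)) (hammingTimes p) u v)
      (cong₂ _+_ (trans (⟦raise⟧ (scale (+ m) p) u v) (⟦scale⟧ (+ m) p u v)) (⟦hammingTimes⟧ p u v))
    expand : ∀ m Q D P → (m - Q + D) * P ≡ m * P + D * P + Q * (-1ℤ * P)
    expand = solve-∀
  ⟦hammingTimes⟧ (p +q* r) (x ∷ u) (y ∷ v) = sym (begin
    + n * + hamming (x ∷ u) (y ∷ v) * (P + Q * R)   ≡⟨ cong (_* (P + Q * R)) (hamming-∷ x y u v) ⟩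
    (+ m - Q + D) * (P + Q * R)                     ≡⟨ expand (+ m) Q D P R ⟩
    E (Q * Q)                                       ≡⟨ cong E (q² x y) ⟩
    E ((+ m - 1ℤ) * Q + + m)                        ≡⟨ collect (+ m) Q D P R ⟩
    + m * P + (- + m) * R + D * P + Q * (R + -1ℤ * P + D * R)
      ≡⟨ sym (cong₂ (λ a b → a + Q * b) first second) ⟩
    ⟦ hammingTimes (p +q* r) ⟧ (x ∷ u) (y ∷ v) ∎)
    where
    P = ⟦ p ⟧ u v
    R = ⟦ r ⟧ u v
    Q = q x y
    D = + n * + hamming u v
    E : ℤ → ℤ
    E S = + m * P + + m * Q * R - Q * P - S * R + D * P + D * Q * R
    expand : ∀ m Q D P R → (m - Q + D) * (P + Q * R) ≡
             m * P + m * Q * R - Q * P - Q * Q * R + D * P + D * Q * R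
    expand = solve-∀
    collect : ∀ m Q D P R → m * P + m * Q * R - Q * P - ((m - 1ℤ) * Q + m) * R + D * P + D * Q * R ≡
              m * P + (- m) * R + D * P + Q * (R + -1ℤ * P + D * R)
    collect = solve-∀
    first : ⟦ raise (scale (+ m) p) ⊕ raise (raise (scale (- + m) r)) ⊕ hammingTimes p ⟧ u v ≡
            + m * P + (- + m) * R + D * P
    first = trans (⟦⊕⟧ (p₀ ⊕ r₀) (hammingTimes p) u v) (cong₂ _+_
      (trans (⟦⊕⟧ p₀ r₀ u v) (cong₂ _+_
        (trans (⟦raise⟧ (scale (+ m) p) u v) (⟦scale⟧ (+ m) p u v))
        (trans (⟦raise⟧ (raise (scale (- + m) r)) u v)
               (trans (⟦raise⟧ (scale (- + m) r) u v) (⟦scale⟧ (- + m) r u v)))))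
      (⟦hammingTimes⟧ p u v))
      where
      p₀ = raise (scale (+ m) p)
      r₀ = raise (raise (scale (- + m) r))
    second : ⟦ raise r ⊕ scale -1ℤ p ⊕ hammingTimes r ⟧ u v ≡ R + -1ℤ * P + D * R
    second = trans (⟦⊕⟧ (raise r ⊕ scale -1ℤ p) (hammingTimes r) u v) (cong₂ _+_
      (trans (⟦⊕⟧ (raise r) (scale -1ℤ p) u v) (cong₂ _+_ (⟦raise⟧ r u v) (⟦scale⟧ -1ℤ p u v)))
      (⟦hammingTimes⟧ r u v))

  -- rank k j = Σ_{s ≤ j} C(k,s) m^s: one factor q, of rank m, per variable of a monomial.
  rank : ℕ → ℕ → ℕ
  rank zero    j       = 1
  rank (suc k) zero    = rank k 0
  rank (suc k) (suc j) = rank k (suc j) ℕ.+ m ℕ.* rank k j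

  factorisation : ∀ {k j} (p : QPoly k j) → Factorisation (rank k j) ⟦ p ⟧
  factorisation (const c) = Factorisation-resp (λ { [] [] → ℤ.*-identityʳ c })
    (Factorisation-rankOne (λ _ → c) (λ _ → 1ℤ))
  factorisation (lift p) = Factorisation-resp (λ { (_ ∷ _) (_ ∷ _) → refl })
    (Factorisation-∘ tail (factorisation p))
  factorisation (p +q* r) = Factorisation-resp (λ { (_ ∷ _) (_ ∷ _) → refl })
    (Factorisation-+ (Factorisation-∘ tail (factorisation p))
                     (Factorisation-* (Factorisation-∘ head q-factorisation) (Factorisation-∘ tail (factorisation r))))

  rank≤ : ∀ k j .{{_ : NonZero m}} → rank k j ≤ 2 ^ k ℕ.* m ^ j
  rank≤ zero    j       = ≤-trans (m^n>0 m j) (≤-reflexive (sym (+-identityʳ (m ^ j))))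
  rank≤ (suc k) zero    = ≤-trans (rank≤ k 0) (*-monoˡ-≤ 1 (m≤m+n (2 ^ k) _))
  rank≤ (suc k) (suc j) = ≤-trans (+-mono-≤ (rank≤ k (suc j)) (*-monoʳ-≤ m (rank≤ k j)))
    (≤-reflexive (double (2 ^ k) m (m ^ j)))
    where
    double : ∀ p m q → p ℕ.* (m ℕ.* q) ℕ.+ m ℕ.* (p ℕ.* q) ≡ (2 ℕ.* p) ℕ.* (m ℕ.* q)
    double = ℕ-Solver.solve-∀

  vanish : ℕ → ℕ → ℤ
  vanish zero    d = 1ℤ
  vanish (suc t) d = + n * (+ d - + (suc t ℕ.* 2)) * vanish t d

  vanish-0≢0 : ∀ t → vanish t 0 ≢ 0ℤ
  vanish-0≢0 zero ()
  vanish-0≢0 (suc t) eq with ℤ.i*j≡0⇒i≡0∨j≡0 (+ n * (0ℤ - + (suc t ℕ.* 2))) eq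
  ... | inj₂ vanish≡0 = vanish-0≢0 t vanish≡0
  ... | inj₁ factor≡0 with ℤ.i*j≡0⇒i≡0∨j≡0 (+ n) factor≡0
  ...   | inj₁ ()
  ...   | inj₂ ()

  vanish-root : ∀ {s t} → 1 ≤ s → s ≤ t → vanish t (s ℕ.* 2) ≡ 0ℤ
  vanish-root {t = zero}  (s≤s _) ()
  vanish-root {s} {suc t} 1≤s s≤1+t with s ℕ.≟ suc t
  ... | yes refl = root (+ n) (+ (s ℕ.* 2)) (vanish t (s ℕ.* 2))
    where
    root : ∀ a b c → a * (b - b) * c ≡ 0ℤ
    root = solve-∀
  ... | no s≢1+t =
    trans (cong (factor *_) (vanish-root 1≤s (≤-pred (≤∧≢⇒< s≤1+t s≢1+t)))) (ℤ.*-zeroʳ factor)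
    where
    factor = + n * (+ (s ℕ.* 2) - + (suc t ℕ.* 2))

  vanishingQPoly : ∀ k t → QPoly k t
  vanishingQPoly k zero    = constant k 1ℤ
  vanishingQPoly k (suc t) = hammingTimes p ⊕ raise (scale (- (+ n * + (suc t ℕ.* 2))) p)
    where
    p = vanishingQPoly k t

  ⟦vanishingQPoly⟧ : ∀ {k} t (u v : Word k) → ⟦ vanishingQPoly k t ⟧ u v ≡ vanish t (hamming u v)
  ⟦vanishingQPoly⟧ {k} zero    u v = ⟦constant⟧ k 1ℤ u v
  ⟦vanishingQPoly⟧ {k} (suc t) u v = begin
    ⟦ hammingTimes p ⊕ raise (scale c p) ⟧ u v
      ≡⟨ ⟦⊕⟧ (hammingTimes p) (raise (scale c p)) u v ⟩
    ⟦ hammingTimes p ⟧ u v + ⟦ raise (scale c p) ⟧ u v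
      ≡⟨ cong₂ _+_ (⟦hammingTimes⟧ p u v) (trans (⟦raise⟧ (scale c p) u v) (⟦scale⟧ c p u v)) ⟩
    + n * + hamming u v * ⟦ p ⟧ u v + c * ⟦ p ⟧ u v
      ≡⟨ cong (λ w → + n * + hamming u v * w + c * w) (⟦vanishingQPoly⟧ t u v) ⟩
    + n * + hamming u v * vanish t (hamming u v) + c * vanish t (hamming u v)
      ≡⟨ factor (+ n) (+ hamming u v) (+ (suc t ℕ.* 2)) (vanish t (hamming u v)) ⟩
    vanish (suc t) (hamming u v) ∎
    where
    p = vanishingQPoly k t
    c = - (+ n * + (suc t ℕ.* 2))
    factor : ∀ a d e w → a * d * w + (- (a * e)) * w ≡ a * (d - e) * w
    factor = solve-∀

  hamming-refl : ∀ {k} (u : Word k) → hamming u u ≡ 0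
  hamming-refl []      = refl
  hamming-refl (x ∷ u) with x ≟ x
  ... | yes _   = hamming-refl u
  ... | no x≢x = ⊥-elim (x≢x refl)

  hamming≡0⇒≡ : ∀ {k} (u v : Word k) → hamming u v ≡ 0 → u ≡ v
  hamming≡0⇒≡ []      []      _ = refl
  hamming≡0⇒≡ (x ∷ u) (y ∷ v) d≡0 with x ≟ y
  ... | yes refl = cong (x ∷_) (hamming≡0⇒≡ u v d≡0)

  hamming≤length : ∀ {k} (u v : Word k) → hamming u v ≤ k
  hamming≤length []      []      = z≤n
  hamming≤length (x ∷ u) (y ∷ v) with x ≟ y
  ... | yes _ = m≤n⇒m≤1+n (hamming≤length u v)
  ... | no _  = s≤s (hamming≤length u v)

  *2≤⇒≤⌊/2⌋ : ∀ {s k} → s ℕ.* 2 ≤ k → s ≤ ⌊ k /2⌋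
  *2≤⇒≤⌊/2⌋ {zero}              _                 = z≤n
  *2≤⇒≤⌊/2⌋ {suc s} {suc (suc k)} (s≤s (s≤s 2s≤k)) = s≤s (*2≤⇒≤⌊/2⌋ 2s≤k)

  evenCode≤rank : ∀ k {L} (c : Fin L → Word k) → (∀ i j → i ≢ j → c i ≢ c j) →
                  (∀ i j → i ≢ j → 2 ∣ hamming (c i) (c j)) → L ≤ rank k ⌊ k /2⌋
  evenCode≤rank k c injective even = diagonal≤rank (factorisation p) c diagonal offDiagonal
    where
    t = ⌊ k /2⌋
    p = vanishingQPoly k t
    diagonal : ∀ i → ⟦ p ⟧ (c i) (c i) ≢ 0ℤ
    diagonal i = vanish-0≢0 t ∘ trans (sym (cong (vanish t) (hamming-refl (c i))))
                              ∘ trans (sym (⟦vanishingQPoly⟧ t (c i) (c i)))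
    offDiagonal : ∀ i j → i ≢ j → ⟦ p ⟧ (c i) (c j) ≡ 0ℤ
    offDiagonal i j i≢j with even i j i≢j
    ... | divides zero    d≡0  = ⊥-elim (injective i j i≢j (hamming≡0⇒≡ (c i) (c j) d≡0))
    ... | divides (suc s) d≡2s = trans (⟦vanishingQPoly⟧ t (c i) (c j)) (trans (cong (vanish t) d≡2s)
          (vanish-root {suc s} (s≤s z≤n) (*2≤⇒≤⌊/2⌋ (subst (_≤ k) d≡2s (hamming≤length (c i) (c j))))))

module Lists where

  open import Data.Nat as ℕ using (zero; suc)
  open import Data.List using (List; []; _∷_; length; map; lookup; concatMap)
  open import Data.List.Properties using (length-++)
  open import Data.List.Membership.Propositional using (_∈_)
  open import Data.List.Membership.Propositional.Properties
    using (∈-map⁻; ∈-map⁺; ∈-++⁺ˡ; ∈-++⁺ʳ; ∈-++⁻; ∈-lookup)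
  open import Data.List.Relation.Unary.Any using (here; there)
  open import Data.List.Relation.Unary.All as All using (All; []; _∷_)
  import Data.List.Relation.Unary.All.Properties as All
  open import Data.List.Relation.Unary.AllPairs as AllPairs using (AllPairs; []; _∷_)
  import Data.List.Relation.Unary.AllPairs.Properties as AllPairs
  open import Data.List.Relation.Unary.Unique.Propositional using (Unique)
  import Data.List.Relation.Unary.Unique.Propositional.Properties as Unique
  open import Data.List.Relation.Binary.Disjoint.Propositional using (Disjoint)
  open import Data.List.Relation.Binary.Sublist.Propositional using (_⊆_; []; _∷_; _∷ʳ_; ⊆-refl)
  open import Data.List.Relation.Binary.Sublist.Propositional.Properties using (All-resp-⊆; ++⁺; ++⁺ˡ; ++⁺ʳ)
  open import Data.Vec using ([]; _∷_)
  open import Data.Vec.Properties using (∷-injectiveˡ; ∷-injectiveʳ)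
  open import Data.Fin using (zero; suc)
  open import Data.Product using (_,_)
  open import Data.Sum using (inj₁; inj₂)
  open import Relation.Binary.PropositionalEquality
  open import Relation.Binary.Definitions using (Symmetric)
  open import Relation.Nullary using (contradiction)
  open import Function using (_∘_)

  module _ {A : Set} where

    ∈-sublists⁺ : ∀ {xs ys : List A} → xs ⊆ ys → xs ∈ sublists ys
    ∈-sublists⁺ []                      = here refl
    ∈-sublists⁺ (refl ∷ xs⊆ys)          = ∈-++⁺ˡ (∈-map⁺ _ (∈-sublists⁺ xs⊆ys))
    ∈-sublists⁺ {ys = y ∷ ys} (.y ∷ʳ xs⊆ys) = ∈-++⁺ʳ (map (y ∷_) (sublists ys)) (∈-sublists⁺ xs⊆ys)

    ∈-sublists⁻ : ∀ {xs : List A} ys → xs ∈ sublists ys → xs ⊆ ys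
    ∈-sublists⁻ []       (here refl) = []
    ∈-sublists⁻ (y ∷ ys) xs∈ with ∈-++⁻ (map (y ∷_) (sublists ys)) xs∈
    ... | inj₂ xs∈′ = y ∷ʳ ∈-sublists⁻ ys xs∈′
    ... | inj₁ y∷xs∈ with ∈-map⁻ (y ∷_) y∷xs∈
    ...   | _ , xs′∈ , refl = refl ∷ ∈-sublists⁻ ys xs′∈

    AllPairs-resp-⊆ : ∀ {R : A → A → Set} {xs ys} → xs ⊆ ys → AllPairs R ys → AllPairs R xs
    AllPairs-resp-⊆ []             []         = []
    AllPairs-resp-⊆ (y ∷ʳ xs⊆ys)   (_ ∷ rys)  = AllPairs-resp-⊆ xs⊆ys rys
    AllPairs-resp-⊆ (refl ∷ xs⊆ys) (rx ∷ rys) = All-resp-⊆ xs⊆ys rx ∷ AllPairs-resp-⊆ xs⊆ys rys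

    AllPairs-lookup : ∀ {R : A → A → Set} → Symmetric R → ∀ {xs} → AllPairs R xs →
                      ∀ i j → i ≢ j → R (lookup xs i) (lookup xs j)
    AllPairs-lookup sym′ (rx ∷ rxs) zero    zero    i≢j = contradiction refl i≢j
    AllPairs-lookup sym′ (rx ∷ rxs) zero    (suc j) _   = All.lookup rx (∈-lookup j)
    AllPairs-lookup sym′ (rx ∷ rxs) (suc i) zero    _   = sym′ (All.lookup rx (∈-lookup i))
    AllPairs-lookup sym′ (rx ∷ rxs) (suc i) (suc j) i≢j = AllPairs-lookup sym′ rxs i j (i≢j ∘ cong suc)

    All⇒AllPairs : ∀ {P : A → Set} {R : A → A → Set} → (∀ {x y} → P x → P y → R x y) →
                   ∀ {xs} → All P xs → AllPairs R xs
    All⇒AllPairs r []         = []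
    All⇒AllPairs r (px ∷ pxs) = All.map (r px) pxs ∷ All⇒AllPairs r pxs

  allVecs-unique : ∀ {A : Set} {xs : List A} k → Unique xs → Unique (allVecs xs k)
  allVecs-unique zero    _     = [] ∷ []
  allVecs-unique {xs = xs} (suc k) xs! = Unique.concat⁺
    (All.map⁺ (All.universal (λ x → Unique.map⁺ ∷-injectiveʳ (allVecs-unique k xs!)) xs))
    (AllPairs.map⁺ (AllPairs.map disjoint xs!))
    where
    disjoint : ∀ {x y} → x ≢ y → Disjoint (map (x ∷_) (allVecs xs k)) (map (y ∷_) (allVecs xs k))
    disjoint x≢y (v∈x , v∈y) with ∈-map⁻ _ v∈x | ∈-map⁻ _ v∈y
    ... | _ , _ , refl | _ , _ , v≡y∷ = x≢y (∷-injectiveˡ v≡y∷)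

  module _ {A B : Set} (F : A → List B) where

    ⊆-concatMap : ∀ {x xs} → x ∈ xs → F x ⊆ concatMap F xs
    ⊆-concatMap {xs = x ∷ xs} (here refl) = ++⁺ʳ (concatMap F xs) ⊆-refl
    ⊆-concatMap {xs = y ∷ xs} (there x∈)  = ++⁺ˡ (F y) (⊆-concatMap x∈)

    concatMap⁺ : ∀ {G : A → List B} → (∀ x → F x ⊆ G x) → ∀ xs → concatMap F xs ⊆ concatMap G xs
    concatMap⁺ F⊆G []       = []
    concatMap⁺ F⊆G (x ∷ xs) = ++⁺ (F⊆G x) (concatMap⁺ F⊆G xs)

    length-concatMap : ∀ {c} → (∀ x → length (F x) ≡ c) → ∀ xs → length (concatMap F xs) ≡ length xs ℕ.* c
    length-concatMap ∣F∣≡c []       = refl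
    length-concatMap ∣F∣≡c (x ∷ xs) =
      trans (length-++ (F x)) (cong₂ ℕ._+_ (∣F∣≡c x) (length-concatMap ∣F∣≡c xs))


module Independence where

  open Lists using (∈-sublists⁺; ∈-sublists⁻)
  open import Data.Nat using (_≤_; _⊔_; z≤n)
  open import Data.Nat.Properties using (⊔-lub; m≤m⊔n; m≤n⊔m; ≤-trans)
  open import Data.Bool using (Bool; true; false; not; _∧_; if_then_else_)
  open import Data.List using (List; []; _∷_; length; foldr)
  open import Data.List.Membership.Propositional using (_∈_)
  open import Data.List.Relation.Unary.Any using (here; there)
  open import Data.List.Relation.Unary.All as All using (All; []; _∷_)
  open import Data.List.Relation.Unary.AllPairs using (AllPairs; []; _∷_)
  open import Data.List.Relation.Binary.Sublist.Propositional using (_⊆_)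
  open import Data.Product using (_×_; _,_)
  open import Relation.Binary.PropositionalEquality
  open import Function using (_∘_)

  NonAdjacent : (G : FinGraph) → V G → V G → Set
  NonAdjacent G x y = adj G x y ≡ false × adj G y x ≡ false

  module _ (G : FinGraph) where

    private
      ∧-≡-true : ∀ {a b} → a ∧ b ≡ true → a ≡ true × b ≡ true
      ∧-≡-true {true} b≡true = refl , b≡true

      not-∧-not : ∀ {a b} → not a ∧ not b ≡ true → a ≡ false × b ≡ false
      not-∧-not {false} {false} _ = refl , refl

      not-∧-not⁻ : ∀ {x y} → NonAdjacent G x y → not (adj G x y) ∧ not (adj G y x) ≡ true
      not-∧-not⁻ (xy , yx) rewrite xy | yx = refl

      allB⇒All : ∀ {p : V G → Bool} xs → allB p xs ≡ true → All (λ y → p y ≡ true) xs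
      allB⇒All []       _   = []
      allB⇒All (x ∷ xs) all with ∧-≡-true all
      ... | px , pxs = px ∷ allB⇒All xs pxs

      All⇒allB : ∀ {p : V G → Bool} {xs} → All (λ y → p y ≡ true) xs → allB p xs ≡ true
      All⇒allB []           = refl
      All⇒allB (px ∷ pxs) rewrite px = All⇒allB pxs

    independent⇒AllPairs : ∀ T → independent G T ≡ true → AllPairs (NonAdjacent G) T
    independent⇒AllPairs []      _     = []
    independent⇒AllPairs (x ∷ T) indep with ∧-≡-true indep
    ... | x-T , indep-T = All.map not-∧-not (allB⇒All T x-T) ∷ independent⇒AllPairs T indep-T

    AllPairs⇒independent : ∀ {T} → AllPairs (NonAdjacent G) T → independent G T ≡ true
    AllPairs⇒independent []                  = refl
    AllPairs⇒independent (x-T ∷ nT) rewrite All⇒allB (All.map not-∧-not⁻ x-T) = AllPairs⇒independent nT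

    private
      largest : List (List (V G)) → ℕ
      largest = foldr (λ S m → (if independent G S then length S else 0) ⊔ m) 0

      largest-lub : ∀ Ss {B} → (∀ {T} → T ∈ Ss → independent G T ≡ true → length T ≤ B) → largest Ss ≤ B
      largest-lub []       _     = z≤n
      largest-lub (S ∷ Ss) bound = ⊔-lub first (largest-lub Ss (bound ∘ there))
        where
        first : (if independent G S then length S else 0) ≤ _
        first with independent G S in indep
        ... | true  = bound (here refl) indep
        ... | false = z≤n

      ≤largest : ∀ {Ss T} → T ∈ Ss → independent G T ≡ true → length T ≤ largest Ss
      ≤largest {S ∷ Ss} (here refl) indep rewrite indep = m≤m⊔n (length S) _
      ≤largest {S ∷ Ss} (there T∈)  indep = ≤-trans (≤largest T∈ indep) (m≤n⊔m _ _)

    α-lub : ∀ {B} → (∀ T → T ⊆ verts G → independent G T ≡ true → length T ≤ B) → α G ≤ B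
    α-lub bound = largest-lub (sublists (verts G)) (λ T∈ → bound _ (∈-sublists⁻ (verts G) T∈))

    ≤α : ∀ {T} → T ⊆ verts G → independent G T ≡ true → length T ≤ α G
    ≤α T⊆ = ≤largest (∈-sublists⁺ T⊆)

module CompleteXorPower (m : ℕ) where

  open HammingKernels m
  open Lists
  open Independence
  open import Data.Nat as ℕ using (zero; suc; _≤_; _^_; ⌊_/2⌋; _%_)
  open import Data.Nat.Properties using (≤-trans)
  open import Data.Nat.DivMod using (m*n%n≡0; m%n<n)
  open import Data.Nat.Divisibility using (_∣_; divides; m%n≡0⇒n∣m)
  open import Data.Bool using (false)
  open import Data.List using (List; []; _∷_; [_]; map; concatMap; lookup; length; allFin)
  open import Data.List.Properties using (length-map; length-tabulate)
  open import Data.List.Membership.Propositional.Properties using (∈-allFin)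
  open import Data.List.Relation.Unary.All as All using (All; []; _∷_)
  import Data.List.Relation.Unary.All.Properties as All
  open import Data.List.Relation.Binary.Sublist.Propositional using (_⊆_; ⊆-refl; ⊆-trans)
  open import Data.List.Relation.Binary.Sublist.Propositional.Properties as Sublist using (++⁺ʳ)
  open import Data.List.Relation.Unary.Unique.Propositional.Properties using (allFin⁺)
  open import Data.Fin using (Fin; zero; suc)
  open import Data.Fin.Properties using (_≟_)
  open import Data.Vec as Vec using ([]; _∷_)
  open import Data.Product using (_,_; proj₁; swap)
  open import Relation.Binary.PropositionalEquality
    using (_≡_; refl; trans; cong; cong₂; subst; ≢-sym; module ≡-Reasoning)
  open import Relation.Nullary using (yes; no)
  open import Relation.Nullary.Decidable using (⌊_⌋)

  even⇒isOdd≡false : ∀ {d} → 2 ∣ d → isOdd d ≡ false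
  even⇒isOdd≡false (divides q refl) = cong (λ r → ⌊ r ℕ.≟ 1 ⌋) (m*n%n≡0 q 2)

  isOdd≡false⇒even : ∀ d → isOdd d ≡ false → 2 ∣ d
  isOdd≡false⇒even d odd≡false = m%n≡0⇒n∣m d 2 (remainder (d % 2) (m%n<n d 2) odd≡false)
    where
    remainder : ∀ r → r ℕ.< 2 → ⌊ r ℕ.≟ 1 ⌋ ≡ false → r ≡ 0
    remainder 0 _ _ = refl
    remainder 1 _ ()
    remainder (suc (suc _)) (ℕ.s≤s (ℕ.s≤s ())) _

  α≤rank : ∀ k → α (xorPower (complete n) k) ≤ rank k ⌊ k /2⌋
  α≤rank k = α-lub (xorPower (complete n) k) λ T T⊆ indep →
    evenCode≤rank k (lookup T)
      (AllPairs-lookup ≢-sym (AllPairs-resp-⊆ T⊆ (allVecs-unique k (allFin⁺ n))))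
      (λ i j i≢j → isOdd≡false⇒even _ (proj₁ (AllPairs-lookup swap (independent⇒AllPairs _ T indep) i j i≢j)))

  α≤2^k*m^⌊k/2⌋ : ∀ k .{{_ : ℕ.NonZero m}} → α (xorPower (complete n) k) ≤ 2 ^ k ℕ.* m ^ ⌊ k /2⌋
  α≤2^k*m^⌊k/2⌋ k = ≤-trans (α≤rank k) (rank≤ k ⌊ k /2⌋)

  data Doubled : ∀ {k} → Word k → Set where
    []   : Doubled []
    pad  : Doubled (zero ∷ [])
    _∷∷_ : ∀ {k} x {w : Word k} → Doubled w → Doubled (x ∷ x ∷ w)

  hamming-Doubled : ∀ {k} {u v : Word k} → Doubled u → Doubled v → 2 ∣ hamming u v
  hamming-Doubled []       []       = divides 0 refl
  hamming-Doubled pad      pad      = divides 0 refl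
  hamming-Doubled (x ∷∷ u) (y ∷∷ v) with x ≟ y | hamming-Doubled u v
  ... | yes _ | even           = even
  ... | no _  | divides s d≡2s = divides (suc s) (cong (λ d → suc (suc d)) d≡2s)

  doubledWords : ∀ k → List (Word k)
  doubledWords zero          = [ [] ]
  doubledWords (suc zero)    = [ zero ∷ [] ]
  doubledWords (suc (suc k)) = concatMap (λ x → map (x ∷_) (map (x ∷_) (doubledWords k))) (allFin n)

  doubledWords-Doubled : ∀ k → All Doubled (doubledWords k)
  doubledWords-Doubled zero          = [] ∷ []
  doubledWords-Doubled (suc zero)    = pad ∷ []
  doubledWords-Doubled (suc (suc k)) = All.concat⁺ (All.map⁺ (All.universal
    (λ x → All.map⁺ (All.map⁺ (All.map (x ∷∷_) (doubledWords-Doubled k)))) (allFin n)))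

  length-doubledWords : ∀ k → length (doubledWords k) ≡ n ^ ⌊ k /2⌋
  length-doubledWords zero          = refl
  length-doubledWords (suc zero)    = refl
  length-doubledWords (suc (suc k)) = begin
    length (doubledWords (suc (suc k)))
      ≡⟨ length-concatMap (λ x → map (x ∷_) (map (x ∷_) (doubledWords k))) length-x∷x∷ (allFin n) ⟩
    length (allFin n) ℕ.* length (doubledWords k)
      ≡⟨ cong₂ ℕ._*_ (length-tabulate {n = n} (λ x → x)) (length-doubledWords k) ⟩
    n ℕ.* n ^ ⌊ k /2⌋ ∎
    where
    open ≡-Reasoning
    length-x∷x∷ : ∀ x → length (map (x ∷_) (map (x ∷_) (doubledWords k))) ≡ length (doubledWords k)
    length-x∷x∷ x = trans (length-map (Vec._∷_ x) (map (x ∷_) (doubledWords k)))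
                          (length-map (Vec._∷_ x) (doubledWords k))

  doubledWords⊆allVecs : ∀ k → doubledWords k ⊆ allVecs (allFin n) k
  doubledWords⊆allVecs zero          = ⊆-refl
  doubledWords⊆allVecs (suc zero)    = ++⁺ʳ _ ⊆-refl
  doubledWords⊆allVecs (suc (suc k)) = concatMap⁺ _ (λ x →
    Sublist.map⁺ (x ∷_) (⊆-trans (Sublist.map⁺ (x ∷_) (doubledWords⊆allVecs k))
                                 (⊆-concatMap extend (∈-allFin x))))
    (allFin n)
    where
    extend : Fin n → List (Word (suc k))
    extend y = map (y ∷_) (allVecs (allFin n) k)

  n^⌊k/2⌋≤α : ∀ k → n ^ ⌊ k /2⌋ ≤ α (xorPower (complete n) k)
  n^⌊k/2⌋≤α k = subst (_≤ α (xorPower (complete n) k)) (length-doubledWords k)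
    (≤α (xorPower (complete n) k) (doubledWords⊆allVecs k)
      (AllPairs⇒independent (xorPower (complete n) k)
        (All⇒AllPairs nonAdjacent (doubledWords-Doubled k))))
    where
    nonAdjacent : ∀ {u v : Word k} → Doubled u → Doubled v → NonAdjacent (xorPower (complete n) k) u v
    nonAdjacent du dv = even⇒isOdd≡false (hamming-Doubled du dv) , even⇒isOdd≡false (hamming-Doubled dv du)

module Asymptotics where

  open import Data.Nat as ℕ using (zero; suc; _≤_; _<_; _+_; _*_; _^_; ⌊_/2⌋; NonZero; z≤n; s≤s)
  open import Data.Nat.Properties
  open import Data.Nat.Tactic.RingSolver using (solve-∀)
  open import Data.Product using (∃-syntax; _,_)
  open import Relation.Binary.PropositionalEquality using (_≡_; refl; sym; trans; cong; subst)

  ^-distribʳ-* : ∀ x y h → (x * y) ^ h ≡ x ^ h * y ^ h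
  ^-distribʳ-* x y zero    = refl
  ^-distribʳ-* x y (suc h) = trans (cong (x * y *_) (^-distribʳ-* x y h)) (interchange x y (x ^ h) (y ^ h))
    where
    interchange : ∀ x y p q → x * y * (p * q) ≡ x * p * (y * q)
    interchange = solve-∀

  bernoulli : ∀ c h → c ^ h * (c + h) ≤ (c + 1) ^ h * c
  bernoulli c zero    = ≤-reflexive (cong (_+ 0) (+-identityʳ c))
  bernoulli c (suc h) = begin
    c ^ suc h * (c + suc h)            ≡⟨ expand c (c ^ h) h ⟩
    c ^ h * (c * (c + h) + c)          ≤⟨ *-monoʳ-≤ (c ^ h) (m≤m+n (c * (c + h) + c) h) ⟩
    c ^ h * (c * (c + h) + c + h)      ≡⟨ factor (c ^ h) c h ⟩
    (c + 1) * (c ^ h * (c + h))        ≤⟨ *-monoʳ-≤ (c + 1) (bernoulli c h) ⟩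
    (c + 1) * ((c + 1) ^ h * c)        ≡⟨ sym (*-assoc (c + 1) ((c + 1) ^ h) c) ⟩
    (c + 1) ^ suc h * c                ∎
    where
    open ≤-Reasoning
    expand : ∀ c p h → c * p * (c + suc h) ≡ p * (c * (c + h) + c)
    expand = solve-∀
    factor : ∀ p c h → p * (c * (c + h) + c + h) ≡ (c + 1) * (p * (c + h))
    factor = solve-∀

  exponential-dominates : ∀ {c e} → c < e → ∀ B → ∃[ K ] (∀ h → K ≤ h → B * c ^ h < e ^ h)
  exponential-dominates {zero} {e} 0<e B = 1 , λ
    { (suc h) _ → subst (_< e ^ suc h) (sym (*-zeroʳ B)) (m^n>0 e {{ℕ.>-nonZero 0<e}} (suc h)) }
  exponential-dominates {c@(suc _)} {e} c<e B = B * c , λ h K≤h → *-cancelʳ-< c (B * c ^ h) (e ^ h) (begin-strict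
    B * c ^ h * c                  <⟨ m<n+m (B * c ^ h * c) (*-monoˡ-< c (m^n>0 c h)) ⟩
    c ^ h * c + B * c ^ h * c      ≡⟨ factor B (c ^ h) c ⟩
    c ^ h * (c + B * c)            ≤⟨ *-monoʳ-≤ (c ^ h) (+-monoʳ-≤ c K≤h) ⟩
    c ^ h * (c + h)                ≤⟨ bernoulli c h ⟩
    (c + 1) ^ h * c                ≤⟨ *-monoˡ-≤ c (^-monoˡ-≤ h (≤-trans (≤-reflexive (+-comm c 1)) c<e)) ⟩
    e ^ h * c                      ∎)
    where
    open ≤-Reasoning
    factor : ∀ B p c → p * c + B * p * c ≡ p * (c + B * c)
    factor = solve-∀

  ≤⌊/2⌋ : ∀ {K k} → K + K ≤ k → K ≤ ⌊ k /2⌋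
  ≤⌊/2⌋ {K} K+K≤k = subst (_≤ _) (sym (n≡⌊n+n/2⌋ K)) (⌊n/2⌋-mono K+K≤k)

  ^≤suc*^⌊/2⌋ : ∀ a k → a ^ k ≤ suc a * (a * a) ^ ⌊ k /2⌋
  ^≤suc*^⌊/2⌋ a zero          = s≤s z≤n
  ^≤suc*^⌊/2⌋ a (suc zero)    = *-monoˡ-≤ 1 (n≤1+n a)
  ^≤suc*^⌊/2⌋ a (suc (suc k)) = begin
    a * (a * a ^ k)                             ≡⟨ sym (*-assoc a a (a ^ k)) ⟩
    a * a * a ^ k                               ≤⟨ *-monoʳ-≤ (a * a) (^≤suc*^⌊/2⌋ a k) ⟩
    a * a * (suc a * (a * a) ^ ⌊ k /2⌋)          ≡⟨ swap (a * a) (suc a) ((a * a) ^ ⌊ k /2⌋) ⟩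
    suc a * (a * a * (a * a) ^ ⌊ k /2⌋)          ∎
    where
    open ≤-Reasoning
    swap : ∀ x y z → x * (y * z) ≡ y * (x * z)
    swap = solve-∀

  ^⌊/2⌋≤^ : ∀ a k .{{_ : NonZero a}} → (a * a) ^ ⌊ k /2⌋ ≤ a ^ k
  ^⌊/2⌋≤^ a zero          = ≤-refl
  ^⌊/2⌋≤^ a (suc zero)    = m^n>0 a 1
  ^⌊/2⌋≤^ a (suc (suc k)) = ≤-trans (*-monoʳ-≤ (a * a) (^⌊/2⌋≤^ a k)) (≤-reflexive (*-assoc a a (a ^ k)))

  eventually-⌊/2⌋ : ∀ {c e} → c < e → ∀ B → ∃[ K ] (∀ k → K ≤ k → B * c ^ ⌊ k /2⌋ < e ^ ⌊ k /2⌋)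
  eventually-⌊/2⌋ c<e B with exponential-dominates c<e B
  ... | K , dominated = K + K , λ k K+K≤k → dominated ⌊ k /2⌋ (≤⌊/2⌋ K+K≤k)

open import Data.Nat using (_*_; _^_; _<_; _≥_; _∸_; NonZero; zero; suc; ⌊_/2⌋; s≤s)
open import Data.Nat.Properties using (*-monoˡ-≤; *-monoʳ-≤; *-mono-≤; module ≤-Reasoning)
open import Data.Nat.Tactic.RingSolver using (solve-∀)
open import Data.Product using (∃-syntax; _×_; _,_)
open import Relation.Binary.PropositionalEquality using (_≡_; cong; sym)
open Asymptotics

√n≤xα : ∀ m (a b : ℕ) → .{{_ : NonZero b}} → a * a < suc m * (b * b) →
        ∃[ K ] ((k : ℕ) → k ≥ K → a ^ k < α (xorPower (complete (suc m)) k) * b ^ k)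
√n≤xα m a b a²<nb² with eventually-⌊/2⌋ a²<nb² (suc a)
... | K , dominated = K , λ k k≥K → let h = ⌊ k /2⌋ in begin-strict
  a ^ k                                      ≤⟨ ^≤suc*^⌊/2⌋ a k ⟩
  suc a * (a * a) ^ h                        <⟨ dominated k k≥K ⟩
  (suc m * (b * b)) ^ h                      ≡⟨ ^-distribʳ-* (suc m) (b * b) h ⟩
  suc m ^ h * (b * b) ^ h                    ≤⟨ *-mono-≤ (CompleteXorPower.n^⌊k/2⌋≤α m k) (^⌊/2⌋≤^ b k) ⟩
  α (xorPower (complete (suc m)) k) * b ^ k  ∎
  where
  open ≤-Reasoning

xα≤2√[n-1] : ∀ m .{{_ : NonZero m}} (a b : ℕ) → .{{_ : NonZero b}} → 4 * m * (b * b) < a * a →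
             ∃[ K ] ((k : ℕ) → k ≥ K → α (xorPower (complete (suc m)) k) * b ^ k < a ^ k)
xα≤2√[n-1] m zero        b ()
xα≤2√[n-1] m a@(suc _) b 4mb²<a² with eventually-⌊/2⌋ 4mb²<a² (suc (2 * b))
... | K , dominated = K , λ k k≥K → let h = ⌊ k /2⌋ in begin-strict
  α (xorPower (complete (suc m)) k) * b ^ k    ≤⟨ *-monoˡ-≤ (b ^ k) (CompleteXorPower.α≤2^k*m^⌊k/2⌋ m k) ⟩
  2 ^ k * m ^ h * b ^ k                        ≡⟨ regroup₁ (2 ^ k) (m ^ h) (b ^ k) ⟩
  m ^ h * (2 ^ k * b ^ k)                      ≡⟨ cong (m ^ h *_) (sym (^-distribʳ-* 2 b k)) ⟩
  m ^ h * (2 * b) ^ k                          ≤⟨ *-monoʳ-≤ (m ^ h) (^≤suc*^⌊/2⌋ (2 * b) k) ⟩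
  m ^ h * (suc (2 * b) * (2 * b * (2 * b)) ^ h) ≡⟨ regroup₂ (m ^ h) (suc (2 * b)) _ ⟩
  suc (2 * b) * (m ^ h * (2 * b * (2 * b)) ^ h) ≡⟨ cong (suc (2 * b) *_) (sym (^-distribʳ-* m _ h)) ⟩
  suc (2 * b) * (m * (2 * b * (2 * b))) ^ h    ≡⟨ cong (λ c → suc (2 * b) * c ^ h) (regroup₃ m b) ⟩
  suc (2 * b) * (4 * m * (b * b)) ^ h          <⟨ dominated k k≥K ⟩
  (a * a) ^ h                                  ≤⟨ ^⌊/2⌋≤^ a k ⟩
  a ^ k                                        ∎
  where
  open ≤-Reasoning
  regroup₁ : ∀ x y z → x * y * z ≡ y * (x * z)
  regroup₁ = solve-∀
  regroup₂ : ∀ x y z → x * (y * z) ≡ y * (x * z)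
  regroup₂ = solve-∀
  regroup₃ : ∀ m b → m * (2 * b * (2 * b)) ≡ 4 * m * (b * b)
  regroup₃ = solve-∀

corollary2p3 : (n : ℕ) → n ≥ 2 →
    ((a b : ℕ) → .{{_ : NonZero b}} → a * a < n * (b * b) →
      ∃[ K ] ((k : ℕ) → k ≥ K → a ^ k < α (xorPower (complete n) k) * b ^ k))
    × ((a b : ℕ) → .{{_ : NonZero b}} → 4 * (n ∸ 1) * (b * b) < a * a →
      ∃[ K ] ((k : ℕ) → k ≥ K → α (xorPower (complete n) k) * b ^ k < a ^ k))
corollary2p3 (suc (suc m)) _ = √n≤xα (suc m) , xα≤2√[n-1] (suc m)
corollary2p3 (suc zero) (s≤s ())
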